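{- Let $G_1$ and $G_2$ be cospectral graphs (their adjacency matrices $A(G_1)$, $A(G_2)$ have the same characteristic polynomial) having a common simple integral eigenvalue $\lambda$. Let $\xi$ be an integral eigenvector of $A(G_1)$ and $\eta$ an integral eigenvector of $A(G_2)$, both corresponding to $\lambda$. If $\|\eta\|/\|\xi\|$ is irrational, then there is no rational orthogonal matrix $Q$ such that $A(G_1)=Q^{\mathrm{T}}A(G_2)Q$.
   Context: $A(X)$ denotes the adjacency matrix of a graph $X$. An eigenvalue is simple if it has algebraic multiplicity one. An integral eigenvector is an eigenvector with all entries integers. $\|\cdot\|$ is the Euclidean norm on $\mathbb{R}^n$. A rational orthogonal matrix is a real orthogonal matrix with all entries rational. -}

module Defs where

open import Data.Nat using (ℕ; zero; suc)
open import Data.Fin using (Fin; zero; suc; punchIn; _≟_)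
open import Data.Bool using (Bool; true; false; if_then_else_)
open import Data.List using (List; []; _∷_)
open import Data.Integer as ℤ using (ℤ; +_)
open import Data.Rational as ℚ using (ℚ; 0ℚ; 1ℚ)
open import Data.Product using (Σ; ∃; _×_; _,_)
open import Relation.Nullary using (¬_; yes; no)
open import Relation.Binary.PropositionalEquality using (_≡_; _≢_)

record Graph (n : ℕ) : Set where
  field
    adj       : Fin n → Fin n → Bool
    symmetric : ∀ i j → adj i j ≡ adj j i
    loopless  : ∀ i → adj i i ≡ false

A : ∀ {n} → Graph n → Fin n → Fin n → ℤ
A X i j = if Graph.adj X i j then + 1 else + 0

∑ℤ : ∀ n → (Fin n → ℤ) → ℤ
∑ℤ zero    f = + 0
∑ℤ (suc n) f = f zero ℤ.+ ∑ℤ n (λ i → f (suc i))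

∑ℚ : ∀ n → (Fin n → ℚ) → ℚ
∑ℚ zero    f = 0ℚ
∑ℚ (suc n) f = f zero ℚ.+ ∑ℚ n (λ i → f (suc i))

-- Polynomials over ℤ as little-endian coefficient lists

Poly : Set
Poly = List ℤ

coeff : Poly → ℕ → ℤ
coeff []       k       = + 0
coeff (a ∷ p)  zero    = a
coeff (a ∷ p)  (suc k) = coeff p k

-- equality of polynomials (coefficientwise; trailing zeros irrelevant)
_≈ₚ_ : Poly → Poly → Set
p ≈ₚ q = ∀ k → coeff p k ≡ coeff q k

_+ₚ_ : Poly → Poly → Poly
[]      +ₚ q       = q
(a ∷ p) +ₚ []      = a ∷ p
(a ∷ p) +ₚ (b ∷ q) = (a ℤ.+ b) ∷ (p +ₚ q)

scaleₚ : ℤ → Poly → Poly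
scaleₚ c []      = []
scaleₚ c (a ∷ p) = (c ℤ.* a) ∷ scaleₚ c p

_*ₚ_ : Poly → Poly → Poly
[]      *ₚ q = []
(a ∷ p) *ₚ q = scaleₚ a q +ₚ (+ 0 ∷ (p *ₚ q))

evalₚ : Poly → ℤ → ℤ
evalₚ []      x = + 0
evalₚ (a ∷ p) x = a ℤ.+ x ℤ.* evalₚ p x

∑ₚ : ∀ n → (Fin n → Poly) → Poly
∑ₚ zero    f = []
∑ₚ (suc n) f = f zero +ₚ ∑ₚ n (λ i → f (suc i))

sign : ℕ → ℤ
sign zero    = + 1
sign (suc k) = ℤ.- sign k

detₚ : ∀ n → (Fin n → Fin n → Poly) → Poly
detₚ zero    M = + 1 ∷ []
detₚ (suc n) M =
  ∑ₚ (suc n) (λ j → scaleₚ (sign (Data.Fin.toℕ j))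
                     (M zero j *ₚ detₚ n (λ i k → M (suc i) (punchIn j k))))

charPoly : ∀ {n} → (Fin n → Fin n → ℤ) → Poly
charPoly {n} M = detₚ n (λ i j → entry i j)
  where
  entry : Fin n → Fin n → Poly
  entry i j with i ≟ j
  ... | yes _ = ℤ.- M i j ∷ + 1 ∷ []
  ... | no  _ = ℤ.- M i j ∷ []

Cospectral : ∀ {n} → Graph n → Graph n → Set
Cospectral G₁ G₂ = charPoly (A G₁) ≈ₚ charPoly (A G₂)

-- λ is a simple eigenvalue of M: root of the characteristic polynomial of
-- algebraic multiplicity exactly one, i.e. charPoly M = (x - λ) q with q(λ) ≠ 0
SimpleEigenvalue : ∀ {n} → (Fin n → Fin n → ℤ) → ℤ → Set
SimpleEigenvalue M λ′ =
  Σ Poly (λ q → (charPoly M ≈ₚ ((ℤ.- λ′ ∷ + 1 ∷ []) *ₚ q)) × (evalₚ q λ′ ≢ + 0))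

IntegralEigenvector : ∀ {n} → (Fin n → Fin n → ℤ) → ℤ → (Fin n → ℤ) → Set
IntegralEigenvector {n} M λ′ ξ =
  (∃ λ i → ξ i ≢ + 0) × (∀ i → ∑ℤ n (λ j → M i j ℤ.* ξ j) ≡ λ′ ℤ.* ξ i)

normSq : ∀ {n} → (Fin n → ℤ) → ℤ
normSq {n} ξ = ∑ℤ n (λ i → ξ i ℤ.* ξ i)

toℚ : ℤ → ℚ
toℚ z = z ℚ./ 1

-- ‖η‖/‖ξ‖ = sqrt(normSq η / normSq ξ) is irrational, i.e. there is no
-- rational r with r = ‖η‖/‖ξ‖; equivalently (both sides nonnegative)
-- no rational r with r² ‖ξ‖² = ‖η‖².
NormRatioIrrational : ∀ {n} → (Fin n → ℤ) → (Fin n → ℤ) → Set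
NormRatioIrrational ξ η =
  ¬ (Σ ℚ (λ r → (0ℚ ℚ.≤ r) × ((r ℚ.* r) ℚ.* toℚ (normSq ξ) ≡ toℚ (normSq η))))

MatQ : ℕ → Set
MatQ n = Fin n → Fin n → ℚ

transpose : ∀ {n} → MatQ n → MatQ n
transpose M i j = M j i

_·_ : ∀ {n} → MatQ n → MatQ n → MatQ n
_·_ {n} M N i j = ∑ℚ n (λ k → M i k ℚ.* N k j)

idQ : ∀ {n} → MatQ n
idQ i j with i ≟ j
... | yes _ = 1ℚ
... | no  _ = 0ℚ

-- rational orthogonal matrix: Qᵀ Q = I (for square matrices equivalent to Q Qᵀ = I)
RationalOrthogonal : ∀ {n} → MatQ n → Set
RationalOrthogonal Q = ∀ i j → (transpose Q · Q) i j ≡ idQ i j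

toMatQ : ∀ {n} → (Fin n → Fin n → ℤ) → MatQ n
toMatQ M i j = toℚ (M i j)

_≡ₘ_ : ∀ {n} → MatQ n → MatQ n → Set
M ≡ₘ N = ∀ i j → M i j ≡ N i j

-- Suppose A₁ = QᵀA₂Q with Q rational orthogonal. Then Qξ is a rational
-- eigenvector of A₂ for λ (QᵀQ = I makes Qᵀ injective, since n + 1 vectors in
-- ℚⁿ are linearly dependent), and clearing denominators turns it into an
-- integral eigenvector W = N·Qξ. Integral eigenvectors for a simple eigenvalue
-- are proportional: if w vanishes at a coordinate k where η does not, then in
-- det((λ + t)I − A) = t·q(λ + t) replacing rows k and l by η and w extracts a
-- second factor t, so every integer t ≠ 0 divides η_k w_l q(λ) and w_l = 0.
-- Hence η_k W = W_k η, and as Q preserves norms, N² η_k² ‖ξ‖² = W_k² ‖η‖²: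
-- the ratio ‖η‖/‖ξ‖ = |N η_k / W_k| is rational.

module Submission where

open import Defs
open import Data.Nat using (ℕ)
open import Data.Integer using (ℤ)
open import Data.Fin using (Fin)
open import Data.Product using (Σ; _×_)
open import Relation.Nullary using (¬_)
open import Relation.Binary.PropositionalEquality using (_≡_)

open import Algebra.Bundles using (CommutativeRing)
open import Level using (0ℓ)
open import Relation.Nullary.Decidable.Core using (dec⇒maybe)
open import Data.Rational.Base using (0ℚ)
open import Tactic.RingSolver.Core.AlmostCommutativeRing using (AlmostCommutativeRing; fromCommutativeRing)
import Data.Integer.Properties as ℤ
import Data.Rational.Properties as ℚ

module RingSums {c ℓ} (R : CommutativeRing c ℓ) where
  open import Data.Nat.Base using (zero; suc)
  open import Data.Fin.Base using (zero; suc; punchIn)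
  open import Data.Fin.Properties using (punchInᵢ≢i)
  open import Data.Vec.Functional using (Vector; tail)
  open import Relation.Binary.PropositionalEquality using (_≢_)
  open CommutativeRing R hiding (zero)
  open import Algebra.Properties.Semiring.Sum semiring public
  open import Algebra.Properties.Ring ring using (-0#≈0#)
  open import Algebra.Properties.AbelianGroup +-abelianGroup using (⁻¹-∙-comm)
  open import Algebra.Properties.CommutativeSemigroup *-commutativeSemigroup using (interchange)

  sum-zero : ∀ {n} {f : Vector Carrier n} → (∀ i → f i ≈ 0#) → sum f ≈ 0#
  sum-zero {n} f≈0 = trans (sum-cong-≋ f≈0) (sum-replicate-zero n)

  sum-neg : ∀ {n} (f : Vector Carrier n) → sum (λ i → - f i) ≈ - sum f
  sum-neg {zero}  f = sym -0#≈0#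
  sum-neg {suc n} f = trans (+-congˡ (sum-neg (tail f))) (⁻¹-∙-comm (f zero) (sum (tail f)))

  sum-single : ∀ {n} (k : Fin n) (f : Vector Carrier n) → (∀ j → j ≢ k → f j ≈ 0#) → sum f ≈ f k
  sum-single {suc n} k f off-k≈0 =
    trans (sum-remove {i = k} f)
          (trans (+-congˡ (sum-zero (λ j → off-k≈0 (punchIn k j) (punchInᵢ≢i k j)))) (+-identityʳ (f k)))

  sum-linear : ∀ {n} (F X Y : Vector Carrier n) (a : Carrier) → (∀ j → F j ≈ a * X j + Y j) → sum F ≈ a * sum X + sum Y
  sum-linear F X Y a F≈aX+Y =
    trans (sum-cong-≋ F≈aX+Y) (trans (∑-distrib-+ (λ j → a * X j) Y) (+-congʳ (sym (*-distribˡ-sum a X))))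

  sum-scaled-squares : ∀ {n} (a : Carrier) (u : Vector Carrier n) →
                       sum (λ i → (a * u i) * (a * u i)) ≈ (a * a) * sum (λ i → u i * u i)
  sum-scaled-squares a u =
    trans (sum-cong-≋ λ i → interchange a (u i) a (u i)) (sym (*-distribˡ-sum (a * a) (λ i → u i * u i)))

module ℤΣ = RingSums ℤ.+-*-commutativeRing

module IntegerArithmetic where
  open import Data.Nat.Base as ℕ using (zero; suc)
  import Data.Nat.Properties as ℕ
  open import Data.Integer.Base using (+_; _*_; 0ℤ; ∣_∣; ≢-nonZero)
  open import Data.Product using (∃; _,_)
  open import Data.Empty using (⊥-elim)
  open import Relation.Binary.PropositionalEquality using (refl; sym; trans; cong; _≢_)

  a*b≡0⇒b≡0 : ∀ {a b} → a ≢ 0ℤ → a * b ≡ 0ℤ → b ≡ 0ℤ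
  a*b≡0⇒b≡0 {a} {b} a≢0 ab≡0 = ℤ.*-cancelˡ-≡ a b 0ℤ {{≢-nonZero a≢0}} (trans ab≡0 (sym (ℤ.*-zeroʳ a)))

  a*b*c≡0⇒b≡0 : ∀ {a b c} → a ≢ 0ℤ → c ≢ 0ℤ → (a * b) * c ≡ 0ℤ → b ≡ 0ℤ
  a*b*c≡0⇒b≡0 {a} {b} {c} a≢0 c≢0 abc≡0 =
    a*b≡0⇒b≡0 a≢0 (a*b≡0⇒b≡0 c≢0 (trans (ℤ.*-comm c (a * b)) abc≡0))

  divisible-by-all⇒0 : ∀ x → (∀ t → t ≢ 0ℤ → ∃ λ y → x ≡ t * y) → x ≡ 0ℤ
  divisible-by-all⇒0 x divisible with divisible (+ suc ∣ x ∣) (λ ())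
  ... | y , x≡[1+∣x∣]y = ℤ.∣i∣≡0⇒i≡0 (m≡[1+m]k⇒m≡0 ∣ x ∣ ∣ y ∣ (trans (cong ∣_∣ x≡[1+∣x∣]y) (ℤ.abs-* (+ suc ∣ x ∣) y)))
    where
    m≡[1+m]k⇒m≡0 : ∀ m k → m ≡ suc m ℕ.* k → m ≡ 0
    m≡[1+m]k⇒m≡0 m zero    m≡0 = trans m≡0 (ℕ.*-zeroʳ m)
    m≡[1+m]k⇒m≡0 m (suc k) m≡ = ⊥-elim (ℕ.<-irrefl refl (ℕ.≤-trans (ℕ.m≤m*n (suc m) (suc k)) (ℕ.≤-reflexive (sym m≡))))

module Determinant where
  open import Data.Nat.Base using (zero; suc)
  open import Data.Fin.Base using (zero; suc; punchIn; punchOut; toℕ)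
  open import Data.Fin.Properties using (_≟_; punchInᵢ≢i; punchOut-punchIn; punchOut-cong)
  open import Data.Vec.Functional using (Vector; _∷_; updateAt; map; tail)
  open import Data.Vec.Functional.Properties using (updateAt-updates; updateAt-minimal; updateAt-id-local; map-updateAt)
  open import Data.Integer.Base using (+_; -_; _+_; _*_; 0ℤ; 1ℤ)
  open import Data.Integer.Tactic.RingSolver using (solve-∀)
  open import Data.Empty using (⊥-elim)
  open import Function.Base using (_∘_; const)
  open import Relation.Binary.PropositionalEquality
    using (refl; sym; trans; cong; cong₂; cong-app; _≢_; module ≡-Reasoning)
  open import Relation.Nullary using (yes; no)
  open import Algebra.Properties.AbelianGroup ℤ.+-0-abelianGroup using (identityˡ-unique)
  open ℤΣ using (sum; sum-cong-≗; sum-linear; ∑-comm; *-distribˡ-sum; sum-remove; sum-zero; sum-neg; sum-single)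

  private variable m n : ℕ

  Matrix : ℕ → Set
  Matrix n = Vector (Vector ℤ n) n

  minor : Matrix (suc n) → Fin (suc n) → Matrix n
  minor M j = map (_∘ punchIn j) (tail M)

  σ : Fin n → ℤ
  σ j = sign (toℕ j)

  det : Matrix n → ℤ
  det {zero}  M = 1ℤ
  det {suc n} M = sum λ j → σ j * (M zero j * det (minor M j))

  det-cong : {M N : Matrix n} → (∀ i j → M i j ≡ N i j) → det M ≡ det N
  det-cong {zero}  M≡N = refl
  det-cong {suc n} M≡N = sum-cong-≗ λ j →
    cong₂ (λ a d → σ j * (a * d)) (M≡N zero j) (det-cong λ i k → M≡N (suc i) (punchIn j k))

  _[_]≔_ : ∀ {A : Set} → Vector A n → Fin n → A → Vector A n
  M [ k ]≔ r = updateAt M k (const r)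

  minor-[]≔ : (M : Matrix (suc n)) (k : Fin n) (r : Vector ℤ (suc n)) (j : Fin (suc n)) →
              ∀ i c → minor (M [ suc k ]≔ r) j i c ≡ (minor M j [ k ]≔ (r ∘ punchIn j)) i c
  minor-[]≔ M k r j i = cong-app (map-updateAt {f = _∘ punchIn j} (λ _ → refl) (tail M) k i)

  det-[]≔-linear : (M : Matrix n) (k : Fin n) (a : ℤ) (u v : Vector ℤ n) →
    det (M [ k ]≔ (λ c → a * u c + v c)) ≡ a * det (M [ k ]≔ u) + det (M [ k ]≔ v)
  det-[]≔-linear {suc n} M zero a u v =
    sum-linear _ _ _ a λ j → distrib (σ j) a (u j) (v j) (det (minor M j))
    where
    distrib : ∀ s a x y d → s * ((a * x + y) * d) ≡ a * (s * (x * d)) + s * (y * d)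
    distrib = solve-∀
  det-[]≔-linear {suc n} M (suc k) a u v =
    sum-linear _ _ _ a λ j → trans (cong (λ d → σ j * (M zero j * d)) (expand j)) (distrib (σ j) (M zero j) a _ _)
    where
    distrib : ∀ s m a x y → s * (m * (a * x + y)) ≡ a * (s * (m * x)) + s * (m * y)
    distrib = solve-∀
    expand : ∀ j → det (minor (M [ suc k ]≔ (λ c → a * u c + v c)) j)
                 ≡ a * det (minor (M [ suc k ]≔ u) j) + det (minor (M [ suc k ]≔ v) j)
    expand j = trans (det-cong (minor-[]≔ M k _ j))
      (trans (det-[]≔-linear (minor M j) k a (u ∘ punchIn j) (v ∘ punchIn j))
             (sym (cong₂ (λ x y → a * x + y) (det-cong (minor-[]≔ M k u j)) (det-cong (minor-[]≔ M k v j)))))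

  []≔-cong : (M : Vector (Vector ℤ m) n) (k : Fin n) {r r′ : Vector ℤ m} → (∀ c → r c ≡ r′ c) →
             ∀ i c → (M [ k ]≔ r) i c ≡ (M [ k ]≔ r′) i c
  []≔-cong {suc n} M zero    r≗r′ zero    c = r≗r′ c
  []≔-cong {suc n} M zero    r≗r′ (suc i) c = refl
  []≔-cong {suc n} M (suc k) r≗r′ zero    c = refl
  []≔-cong {suc n} M (suc k) r≗r′ (suc i) c = []≔-cong (tail M) k r≗r′ i c

  det-[]≔-0 : (M : Matrix n) (k : Fin n) → det (M [ k ]≔ (λ _ → 0ℤ)) ≡ 0ℤ
  det-[]≔-0 M k = identityˡ-unique d d (sym (trans (det-[]≔-linear M k (1ℤ) _ _) (cong (_+ d) (ℤ.*-identityˡ d))))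
    where d = det (M [ k ]≔ (λ _ → 0ℤ))

  det-[]≔-* : (M : Matrix n) (k : Fin n) (a : ℤ) (u : Vector ℤ n) →
              det (M [ k ]≔ (λ c → a * u c)) ≡ a * det (M [ k ]≔ u)
  det-[]≔-* M k a u = begin
    det (M [ k ]≔ (λ c → a * u c))          ≡⟨ det-cong ([]≔-cong M k (λ c → sym (ℤ.+-identityʳ (a * u c)))) ⟩
    det (M [ k ]≔ (λ c → a * u c + 0ℤ))    ≡⟨ det-[]≔-linear M k a u (λ _ → 0ℤ) ⟩
    a * det (M [ k ]≔ u) + det (M [ k ]≔ (λ _ → 0ℤ))
                                            ≡⟨ cong (_+_ (a * det (M [ k ]≔ u))) (det-[]≔-0 M k) ⟩
    a * det (M [ k ]≔ u) + 0ℤ              ≡⟨ ℤ.+-identityʳ _ ⟩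
    a * det (M [ k ]≔ u)                    ∎
    where open ≡-Reasoning

  det-[]≔-∑ : (M : Matrix n) (k : Fin n) (w : Vector ℤ m) (R : Vector (Vector ℤ n) m) →
              det (M [ k ]≔ (λ c → sum λ a → w a * R a c)) ≡ sum λ a → w a * det (M [ k ]≔ R a)
  det-[]≔-∑ {m = zero}  M k w R = det-[]≔-0 M k
  det-[]≔-∑ {m = suc m} M k w R =
    trans (det-[]≔-linear M k (w zero) (R zero) _)
          (cong (_+_ (w zero * det (M [ k ]≔ R zero))) (det-[]≔-∑ M k (tail w) (tail R)))

  σ-punchOut-antisym : {a c : Fin (suc (suc n))} (a≢c : a ≢ c) (c≢a : c ≢ a) →
                       σ a * σ (punchOut a≢c) ≡ - (σ c * σ (punchOut c≢a))
  σ-punchOut-antisym {a = zero}  {zero}  a≢c c≢a = ⊥-elim (a≢c refl)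
  σ-punchOut-antisym {a = zero}  {suc c} a≢c c≢a = lemma (σ c)
    where lemma : ∀ s → 1ℤ * s ≡ - ((- s) * 1ℤ)
          lemma = solve-∀
  σ-punchOut-antisym {a = suc a} {zero}  a≢c c≢a = lemma (σ a)
    where lemma : ∀ s → (- s) * 1ℤ ≡ - (1ℤ * s)
          lemma = solve-∀
  σ-punchOut-antisym {n = zero}  {a = suc zero} {suc zero} a≢c c≢a = ⊥-elim (a≢c refl)
  σ-punchOut-antisym {n = suc n} {a = suc a} {suc c} a≢c c≢a =
    trans (lemma (σ a) _) (trans (σ-punchOut-antisym (a≢c ∘ cong suc) (c≢a ∘ cong suc)) (sym (cong -_ (lemma (σ c) _))))
    where lemma : ∀ x y → (- x) * (- y) ≡ x * y
          lemma = solve-∀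

  punchIn-punchOut-comm : {a c : Fin (suc (suc n))} (a≢c : a ≢ c) (c≢a : c ≢ a) (l : Fin n) →
                          punchIn a (punchIn (punchOut a≢c) l) ≡ punchIn c (punchIn (punchOut c≢a) l)
  punchIn-punchOut-comm {a = zero}  {zero}  a≢c c≢a l = ⊥-elim (a≢c refl)
  punchIn-punchOut-comm {a = zero}  {suc c} a≢c c≢a l = refl
  punchIn-punchOut-comm {a = suc a} {zero}  a≢c c≢a l = refl
  punchIn-punchOut-comm {n = suc n} {a = suc a} {suc c} a≢c c≢a zero    = refl
  punchIn-punchOut-comm {n = suc n} {a = suc a} {suc c} a≢c c≢a (suc l) =
    cong suc (punchIn-punchOut-comm (a≢c ∘ cong suc) (c≢a ∘ cong suc) l)

  module _ (R : Vector (Vector ℤ (suc (suc n))) n) where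

    private
      D : Fin (suc (suc n)) → Fin (suc n) → ℤ
      D a b = det λ i c → R i (punchIn a (punchIn b c))

      D-cong : ∀ {a b a′ b′} → (∀ l → punchIn a (punchIn b l) ≡ punchIn a′ (punchIn b′ l)) → D a b ≡ D a′ b′
      D-cong {a} {b} {a′} {b′} eq =
        det-cong {M = λ i l → R i (punchIn a (punchIn b l))} {N = λ i l → R i (punchIn a′ (punchIn b′ l))}
                 λ i l → cong (R i) (eq l)

      T : {a c : Fin (suc (suc n))} → a ≢ c → ℤ
      T {a} a≢c = (σ a * σ (punchOut a≢c)) * D a (punchOut a≢c)

      T-antisym : {a c : Fin (suc (suc n))} (a≢c : a ≢ c) (c≢a : c ≢ a) → T c≢a ≡ - T a≢c
      T-antisym {a} {c} a≢c c≢a = begin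
        (σ c * σ (punchOut c≢a)) * D c (punchOut c≢a)
          ≡⟨ cong (λ s → s * D c (punchOut c≢a)) (sym (ℤ.neg-involutive (σ c * σ (punchOut c≢a)))) ⟩
        (- - (σ c * σ (punchOut c≢a))) * D c (punchOut c≢a)
          ≡⟨ cong (λ s → (- s) * D c (punchOut c≢a)) (sym (σ-punchOut-antisym a≢c c≢a)) ⟩
        (- (σ a * σ (punchOut a≢c))) * D c (punchOut c≢a)
          ≡⟨ cong (λ d → (- (σ a * σ (punchOut a≢c))) * d)
                  (D-cong {c} {punchOut c≢a} {a} {punchOut a≢c} (punchIn-punchOut-comm c≢a a≢c)) ⟩
        (- (σ a * σ (punchOut a≢c))) * D a (punchOut a≢c)
          ≡⟨ sym (ℤ.neg-distribˡ-* (σ a * σ (punchOut a≢c)) (D a (punchOut a≢c))) ⟩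
        - T a≢c ∎
        where open ≡-Reasoning

      -- Term (a, c) of the expansion of det (x ∷ y ∷ R) along its first two rows.
      V : (x y : Vector ℤ (suc (suc n))) (a c : Fin (suc (suc n))) → ℤ
      V x y a c with a ≟ c
      ... | yes _   = 0ℤ
      ... | no  a≢c = (x a * y c) * T a≢c

      V-antisym : ∀ x y a c → V y x c a ≡ - V x y a c
      V-antisym x y a c with a ≟ c | c ≟ a
      ... | yes _   | yes _   = refl
      ... | yes a≡c | no  c≢a = ⊥-elim (c≢a (sym a≡c))
      ... | no  a≢c | yes c≡a = ⊥-elim (a≢c (sym c≡a))
      ... | no  a≢c | no  c≢a =
        trans (cong ((y c * x a) *_) (T-antisym a≢c c≢a)) (lemma (y c) (x a) (T a≢c))
        where lemma : ∀ u v t → (u * v) * (- t) ≡ - ((v * u) * t)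
              lemma = solve-∀

      V-punchIn : ∀ x y a b → V x y a (punchIn a b) ≡ (σ a * x a) * (σ b * (y (punchIn a b) * D a b))
      V-punchIn x y a b with a ≟ punchIn a b
      ... | yes a≡ = ⊥-elim (punchInᵢ≢i a b (sym a≡))
      ... | no  a≢ =
        trans (cong (λ p → (x a * y (punchIn a b)) * ((σ a * σ p) * D a p)) (punchOut-punchIn′ a≢))
              (lemma (σ a) (σ b) (x a) _ _)
        where
        punchOut-punchIn′ : (a≢ : a ≢ punchIn a b) → punchOut a≢ ≡ b
        punchOut-punchIn′ a≢ = trans (punchOut-cong a refl) (punchOut-punchIn a)
        lemma : ∀ s t u v d → (u * v) * ((s * t) * d) ≡ (s * u) * (t * (v * d))
        lemma = solve-∀

      row-expansion : ∀ x y a →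
        σ a * (x a * sum λ b → σ b * (y (punchIn a b) * D a b)) ≡ sum (V x y a)
      row-expansion x y a = sym (begin
        sum (V x y a)                                   ≡⟨ sum-remove {i = a} (V x y a) ⟩
        V x y a a + sum (λ b → V x y a (punchIn a b))   ≡⟨ cong₂ _+_ V-diag (sum-cong-≗ (V-punchIn x y a)) ⟩
        0ℤ + sum (λ b → (σ a * x a) * term b)          ≡⟨ ℤ.+-identityˡ (sum λ b → (σ a * x a) * term b) ⟩
        sum (λ b → (σ a * x a) * term b)                ≡⟨ *-distribˡ-sum (σ a * x a) term ⟨
        (σ a * x a) * sum term                          ≡⟨ ℤ.*-assoc (σ a) (x a) (sum term) ⟩
        σ a * (x a * sum term)                          ∎)
        where
        open ≡-Reasoning
        term : Fin (suc n) → ℤ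
        term b = σ b * (y (punchIn a b) * D a b)
        V-diag : V x y a a ≡ 0ℤ
        V-diag with a ≟ a
        ... | yes _   = refl
        ... | no  a≢a = ⊥-elim (a≢a refl)

    det-swap : (x y : Vector ℤ (suc (suc n))) → det (y ∷ x ∷ R) ≡ - det (x ∷ y ∷ R)
    det-swap x y = begin
      det (y ∷ x ∷ R)                                 ≡⟨ sum-cong-≗ (row-expansion y x) ⟩
      sum (λ c → sum λ a → V y x c a)                 ≡⟨ sum-cong-≗ (λ c → sum-cong-≗ λ a → V-antisym x y a c) ⟩
      sum (λ c → sum λ a → - V x y a c)               ≡⟨ sum-cong-≗ (λ c → sum-neg λ a → V x y a c) ⟩
      sum (λ c → - sum λ a → V x y a c)               ≡⟨ sum-neg (λ c → sum λ a → V x y a c) ⟩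
      - sum (λ c → sum λ a → V x y a c)               ≡⟨ cong -_ (∑-comm (λ c a → V x y a c)) ⟩
      - sum (λ a → sum λ c → V x y a c)               ≡⟨ cong -_ (sum-cong-≗ (row-expansion x y)) ⟨
      - det (x ∷ y ∷ R)                               ∎
      where open ≡-Reasoning

  private
    x≡-x⇒x≡0 : ∀ x → x ≡ - x → x ≡ 0ℤ
    x≡-x⇒x≡0 x x≡-x = ℤ.*-cancelˡ-≡ (+ 2) x 0ℤ (begin
      + 2 * x   ≡⟨ double x ⟩
      x + x     ≡⟨ cong (_+_ x) x≡-x ⟩
      x + - x   ≡⟨ ℤ.+-inverseʳ x ⟩
      0ℤ        ≡⟨ ℤ.*-zeroʳ (+ 2) ⟨
      + 2 * 0ℤ  ∎)
      where
      open ≡-Reasoning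
      double : ∀ x → + 2 * x ≡ x + x
      double = solve-∀

    σ*[m*0]≡0 : ∀ (a : Fin n) m → σ a * (m * 0ℤ) ≡ 0ℤ
    σ*[m*0]≡0 a m = trans (cong (σ a *_) (ℤ.*-zeroʳ m)) (ℤ.*-zeroʳ (σ a))

  det-row₀≡row : (M : Matrix (suc (suc n))) (j : Fin (suc n)) → (∀ c → M zero c ≡ M (suc j) c) → det M ≡ 0ℤ
  det-row₀≡row M zero M₀≡M₁ =
    x≡-x⇒x≡0 (det M) (trans (sym (det-cong rows₀₁-swapped)) (det-swap (tail (tail M)) (M zero) (M (suc zero))))
    where
    rows₀₁-swapped : ∀ i c → (M (suc zero) ∷ M zero ∷ tail (tail M)) i c ≡ M i c
    rows₀₁-swapped zero          c = sym (M₀≡M₁ c)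
    rows₀₁-swapped (suc zero)    c = M₀≡M₁ c
    rows₀₁-swapped (suc (suc i)) c = refl
  det-row₀≡row {suc n} M (suc j) M₀≡M = begin
    det M                                     ≡⟨ det-swap (tail (tail M)) (M (suc zero)) (M zero) ⟩
    - det M′                                  ≡⟨ cong -_ (sum-zero λ a → trans (cong (λ d → σ a * (M′ zero a * d)) (minor-vanishes a))
                                                                              (σ*[m*0]≡0 a (M′ zero a))) ⟩
    - 0ℤ                                     ≡⟨⟩
    0ℤ                                       ∎
    where
    open ≡-Reasoning
    M′ : Matrix (suc (suc (suc n)))
    M′ = M (suc zero) ∷ M zero ∷ tail (tail M)
    minor-vanishes : ∀ a → det (minor M′ a) ≡ 0ℤ
    minor-vanishes a = det-row₀≡row (minor M′ a) j (λ c → M₀≡M (punchIn a c))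

  det-equal-rows : (M : Matrix n) {i j : Fin n} → i ≢ j → (∀ c → M i c ≡ M j c) → det M ≡ 0ℤ
  det-equal-rows M {zero}  {zero}  i≢j Mi≡Mj = ⊥-elim (i≢j refl)
  det-equal-rows {suc (suc n)} M {zero}  {suc j} i≢j Mi≡Mj = det-row₀≡row M j Mi≡Mj
  det-equal-rows {suc (suc n)} M {suc i} {zero}  i≢j Mi≡Mj = det-row₀≡row M i (λ c → sym (Mi≡Mj c))
  det-equal-rows {suc n} M {suc i} {suc j} i≢j Mi≡Mj = sum-zero λ a →
    trans (cong (λ d → σ a * (M zero a * d)) (det-equal-rows (minor M a) (i≢j ∘ cong suc) (λ c → Mi≡Mj (punchIn a c))))
          (σ*[m*0]≡0 a (M zero a))

  det-[]≔-row-combination : (M : Matrix n) (k : Fin n) (w : Vector ℤ n) →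
                            det (M [ k ]≔ (λ c → sum λ j → w j * M j c)) ≡ w k * det M
  det-[]≔-row-combination M k w = begin
    det (M [ k ]≔ (λ c → sum λ j → w j * M j c))  ≡⟨ det-[]≔-∑ M k w M ⟩
    sum (λ j → w j * det (M [ k ]≔ M j))          ≡⟨ sum-single k _ off-k ⟩
    w k * det (M [ k ]≔ M k)                      ≡⟨ cong (w k *_) (det-cong λ i → cong-app (updateAt-id-local k M refl i)) ⟩
    w k * det M                                   ∎
    where
    open ≡-Reasoning
    off-k : ∀ j → j ≢ k → w j * det (M [ k ]≔ M j) ≡ 0ℤ
    off-k j j≢k = trans (cong (w j *_) (det-equal-rows (M [ k ]≔ M j) j≢k rowⱼ≡rowₖ)) (ℤ.*-zeroʳ (w j))
      where
      rowⱼ≡rowₖ : ∀ c → (M [ k ]≔ M j) j c ≡ (M [ k ]≔ M j) k c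
      rowⱼ≡rowₖ c = cong-app (trans (updateAt-minimal j k M j≢k) (sym (updateAt-updates k M))) c

  det-[]≔-left-eigenvector : (N : Matrix n) (k : Fin n) (w : Vector ℤ n) (t : ℤ) →
                     (∀ c → sum (λ j → w j * N j c) ≡ t * w c) → w k * det N ≡ t * det (N [ k ]≔ w)
  det-[]≔-left-eigenvector N k w t wN≡tw = begin
    w k * det N                                   ≡⟨ det-[]≔-row-combination N k w ⟨
    det (N [ k ]≔ (λ c → sum λ j → w j * N j c))  ≡⟨ det-cong ([]≔-cong N k wN≡tw) ⟩
    det (N [ k ]≔ (λ c → t * w c))                ≡⟨ det-[]≔-* N k t w ⟩
    t * det (N [ k ]≔ w)                          ∎
    where open ≡-Reasoning

module CharacteristicPolynomial where
  open import Data.Nat.Base using (zero; suc)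
  open import Data.Fin.Base using (zero; suc; punchIn)
  open import Data.Fin.Properties using (_≟_)
  open import Data.List.Base using ([]; _∷_)
  open import Data.Vec.Functional using (Vector)
  open import Data.Integer.Base using (-_; _+_; _-_; _*_; 0ℤ; 1ℤ)
  open import Data.Integer.Tactic.RingSolver using (solve-∀)
  open import Data.Product using (proj₁; _,_; ∃)
  open import Data.Empty using (⊥-elim)
  open import Function.Base using (_∘_)
  open import Relation.Binary.PropositionalEquality using (refl; sym; trans; cong; cong₂; _≢_)
  open import Relation.Nullary using (yes; no)
  open ℤΣ using (sum; sum-cong-≗; sum-single)
  open Determinant

  private variable n : ℕ

  eval-+ₚ : ∀ p q x → evalₚ (p +ₚ q) x ≡ evalₚ p x + evalₚ q x
  eval-+ₚ []      q       x = sym (ℤ.+-identityˡ _)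
  eval-+ₚ (a ∷ p) []      x = sym (ℤ.+-identityʳ _)
  eval-+ₚ (a ∷ p) (b ∷ q) x =
    trans (cong (λ e → (a + b) + x * e) (eval-+ₚ p q x)) (lemma a b x (evalₚ p x) (evalₚ q x))
    where lemma : ∀ a b x P Q → (a + b) + x * (P + Q) ≡ (a + x * P) + (b + x * Q)
          lemma = solve-∀

  eval-scaleₚ : ∀ c p x → evalₚ (scaleₚ c p) x ≡ c * evalₚ p x
  eval-scaleₚ c []      x = sym (ℤ.*-zeroʳ c)
  eval-scaleₚ c (a ∷ p) x = trans (cong (λ e → c * a + x * e) (eval-scaleₚ c p x)) (lemma c a x (evalₚ p x))
    where lemma : ∀ c a x P → c * a + x * (c * P) ≡ c * (a + x * P)
          lemma = solve-∀

  eval-*ₚ : ∀ p q x → evalₚ (p *ₚ q) x ≡ evalₚ p x * evalₚ q x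
  eval-*ₚ []      q x = refl
  eval-*ₚ (a ∷ p) q x = trans (eval-+ₚ (scaleₚ a q) (0ℤ ∷ (p *ₚ q)) x)
    (trans (cong₂ (λ u v → u + (0ℤ + x * v)) (eval-scaleₚ a q x) (eval-*ₚ p q x)) (lemma a x (evalₚ p x) (evalₚ q x)))
    where lemma : ∀ a x P Q → a * Q + (0ℤ + x * (P * Q)) ≡ (a + x * P) * Q
          lemma = solve-∀

  eval-∑ₚ : ∀ n (f : Fin n → Poly) x → evalₚ (∑ₚ n f) x ≡ sum (λ i → evalₚ (f i) x)
  eval-∑ₚ zero    f x = refl
  eval-∑ₚ (suc n) f x = trans (eval-+ₚ (f zero) _ x) (cong (_+_ (evalₚ (f zero) x)) (eval-∑ₚ n (λ i → f (suc i)) x))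

  eval-detₚ : ∀ n (E : Fin n → Fin n → Poly) x → evalₚ (detₚ n E) x ≡ det (λ i j → evalₚ (E i j) x)
  eval-detₚ zero    E x = trans (cong (_+_ 1ℤ) (ℤ.*-zeroʳ x)) (ℤ.+-identityʳ 1ℤ)
  eval-detₚ (suc n) E x = trans (eval-∑ₚ (suc n) (λ j → scaleₚ (σ j) (E zero j *ₚ detₚ n (minorₚ j))) x) (sum-cong-≗ λ j →
    trans (eval-scaleₚ (σ j) (E zero j *ₚ detₚ n (minorₚ j)) x) (cong (σ j *_) (trans (eval-*ₚ (E zero j) (detₚ n (minorₚ j)) x)
      (cong (evalₚ (E zero j) x *_) (eval-detₚ n (minorₚ j) x)))))
    where
    minorₚ : Fin (suc n) → Fin n → Fin n → Poly
    minorₚ j i k = E (suc i) (punchIn j k)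

  eval-≈ₚ : ∀ p q x → p ≈ₚ q → evalₚ p x ≡ evalₚ q x
  eval-≈ₚ []      []      x p≈q = refl
  eval-≈ₚ []      (b ∷ q) x p≈q = sym (trans (cong₂ (λ u v → u + x * v) (sym (p≈q 0)) (sym (eval-≈ₚ [] q x (p≈q ∘ suc))))
                                           (cong (_+_ 0ℤ) (ℤ.*-zeroʳ x)))
  eval-≈ₚ (a ∷ p) []      x p≈q = trans (cong₂ (λ u v → u + x * v) (p≈q 0) (eval-≈ₚ p [] x (p≈q ∘ suc)))
                                        (cong (_+_ 0ℤ) (ℤ.*-zeroʳ x))
  eval-≈ₚ (a ∷ p) (b ∷ q) x p≈q = cong₂ (λ u v → u + x * v) (p≈q 0) (eval-≈ₚ p q x (p≈q ∘ suc))

  eval-shift : ∀ p a t → ∃ λ e → evalₚ p (a + t) ≡ evalₚ p a + t * e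
  eval-shift []      a t = 0ℤ , sym (trans (ℤ.+-identityˡ (t * 0ℤ)) (ℤ.*-zeroʳ t))
  eval-shift (b ∷ p) a t with eval-shift p a t
  ... | e , p[a+t]≡p[a]+te = evalₚ p a + (a + t) * e , trans (cong (λ v → b + (a + t) * v) p[a+t]≡p[a]+te) (lemma b a t (evalₚ p a) e)
    where lemma : ∀ b a t P e → b + (a + t) * (P + t * e) ≡ (b + a * P) + t * (P + (a + t) * e)
          lemma = solve-∀

  δ : Fin n → Fin n → ℤ
  δ i j with i ≟ j
  ... | yes _ = 1ℤ
  ... | no  _ = 0ℤ

  xI-_ : Matrix n → ℤ → Matrix n
  (xI- M) x i j = x * δ i j - M i j

  δ-diag : (i : Fin n) → δ i i ≡ 1ℤ
  δ-diag i with i ≟ i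
  ... | yes _   = refl
  ... | no  i≢i = ⊥-elim (i≢i refl)

  δ-off : {i j : Fin n} → i ≢ j → δ i j ≡ 0ℤ
  δ-off {i = i} {j} i≢j with i ≟ j
  ... | yes i≡j = ⊥-elim (i≢j i≡j)
  ... | no  _   = refl

  sum-δ : (v : Vector ℤ n) (c : Fin n) → sum (λ j → v j * δ j c) ≡ v c
  sum-δ v c = trans (sum-single c _ λ j j≢c → trans (cong (v j *_) (δ-off j≢c)) (ℤ.*-zeroʳ (v j)))
                    (trans (cong (v c *_) (δ-diag c)) (ℤ.*-identityʳ (v c)))

  -- charPoly M is detₚ of a matrix local to its definition; this gives that matrix a name.
  charPoly-matrix : (M : Matrix n) → Σ (Fin n → Fin n → Poly) λ E → charPoly M ≡ detₚ n E
  charPoly-matrix M = _ , refl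

  charPoly-matrix-eval : (M : Matrix n) (x : ℤ) → ∀ i j → evalₚ (proj₁ (charPoly-matrix M) i j) x ≡ (xI- M) x i j
  charPoly-matrix-eval M x i j with i ≟ j
  ... | yes _ = lemma x (M i j)
    where lemma : ∀ x m → - m + x * (1ℤ + x * 0ℤ) ≡ x * 1ℤ - m
          lemma = solve-∀
  ... | no  _ = lemma x (M i j)
    where lemma : ∀ x m → - m + x * 0ℤ ≡ x * 0ℤ - m
          lemma = solve-∀

  charPoly-eval : (M : Matrix n) (x : ℤ) → evalₚ (charPoly M) x ≡ det ((xI- M) x)
  charPoly-eval {n} M x = trans (eval-detₚ n (proj₁ (charPoly-matrix M)) x) (det-cong (charPoly-matrix-eval M x))

module SimpleEigenvalue where
  open import Data.Fin.Properties using (_≟_)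
  open import Data.List.Base using (_∷_; [])
  open import Data.Vec.Functional using (Vector)
  open import Data.Vec.Functional.Properties using (updateAt-minimal)
  open import Data.Integer.Base using (-_; _+_; _-_; _*_; 0ℤ; 1ℤ; ≢-nonZero)
  open import Data.Integer.Tactic.RingSolver using (solve-∀)
  open import Data.Product using (∃; _,_; proj₁; proj₂)
  open import Relation.Binary.PropositionalEquality
    using (refl; sym; trans; cong; cong₂; cong-app; _≢_; module ≡-Reasoning)
  open import Relation.Nullary using (yes; no)
  open ℤΣ using (sum; sum-cong-≗; sum-linear; sum-neg; *-distribˡ-sum)
  open IntegerArithmetic using (divisible-by-all⇒0; a*b*c≡0⇒b≡0)
  open Determinant
  open CharacteristicPolynomial

  private variable n : ℕ

  IsEigenvector : Matrix n → ℤ → Vector ℤ n → Set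
  IsEigenvector M λ′ v = ∀ i → sum (λ j → M i j * v j) ≡ λ′ * v i

  eigenvector-combination : ∀ {M : Matrix n} {λ′ u v} → IsEigenvector M λ′ u → IsEigenvector M λ′ v →
                            ∀ a b → IsEigenvector M λ′ (λ i → a * u i - b * v i)
  eigenvector-combination {M = M} {λ′} {u} {v} Mu≡λu Mv≡λv a b i = begin
    sum (λ j → M i j * (a * u j - b * v j))                   ≡⟨ sum-linear _ _ _ a (λ j → expand (M i j) a b (u j) (v j)) ⟩
    a * sum (λ j → M i j * u j) + sum (λ j → - (b * (M i j * v j)))
                                                              ≡⟨ cong (_+_ (a * sum (λ j → M i j * u j))) (sum-neg (λ j → b * (M i j * v j))) ⟩
    a * sum (λ j → M i j * u j) - sum (λ j → b * (M i j * v j))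
                                                              ≡⟨ cong (_-_ (a * sum (λ j → M i j * u j))) (*-distribˡ-sum b (λ j → M i j * v j)) ⟨
    a * sum (λ j → M i j * u j) - b * sum (λ j → M i j * v j) ≡⟨ cong₂ (λ x y → a * x - b * y) (Mu≡λu i) (Mv≡λv i) ⟩
    a * (λ′ * u i) - b * (λ′ * v i)                           ≡⟨ factor λ′ a b (u i) (v i) ⟩
    λ′ * (a * u i - b * v i)                                  ∎
    where
    open ≡-Reasoning
    expand : ∀ m a b x y → m * (a * x - b * y) ≡ a * (m * x) + - (b * (m * y))
    expand = solve-∀
    factor : ∀ l a b x y → a * (l * x) - b * (l * y) ≡ l * (a * x - b * y)
    factor = solve-∀

  module _ {A : Matrix n} (A-sym : ∀ i j → A i j ≡ A j i) {λ′ : ℤ} (simple : SimpleEigenvalue A λ′) where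

    private
      q = proj₁ simple
      N : ℤ → Matrix n
      N t = (xI- A) (λ′ + t)

    det-xI-A : ∀ t → det (N t) ≡ t * evalₚ q (λ′ + t)
    det-xI-A t = begin
      det (N t)                                          ≡⟨ charPoly-eval A (λ′ + t) ⟨
      evalₚ (charPoly A) (λ′ + t)                        ≡⟨ eval-≈ₚ (charPoly A) ((- λ′ ∷ 1ℤ ∷ []) *ₚ q) (λ′ + t) (proj₁ (proj₂ simple)) ⟩
      evalₚ ((- λ′ ∷ 1ℤ ∷ []) *ₚ q) (λ′ + t)              ≡⟨ eval-*ₚ (- λ′ ∷ 1ℤ ∷ []) q (λ′ + t) ⟩
      evalₚ (- λ′ ∷ 1ℤ ∷ []) (λ′ + t) * evalₚ q (λ′ + t) ≡⟨ cong (_* evalₚ q (λ′ + t)) (linear λ′ t) ⟩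
      t * evalₚ q (λ′ + t)                               ∎
      where
      open ≡-Reasoning
      linear : ∀ l t → - l + (l + t) * (1ℤ + (l + t) * 0ℤ) ≡ t
      linear = solve-∀

    xI-A-left-eigenvector : ∀ {v} → IsEigenvector A λ′ v → ∀ t c → sum (λ j → v j * N t j c) ≡ t * v c
    xI-A-left-eigenvector {v} Av≡λv t c = begin
      sum (λ j → v j * N t j c)                            ≡⟨ sum-linear _ _ _ (λ′ + t) (λ j → expand (v j) (λ′ + t) (δ j c) (A j c) (A c j) (A-sym j c)) ⟩
      (λ′ + t) * sum (λ j → v j * δ j c) + sum (λ j → - (A c j * v j))
                                                           ≡⟨ cong₂ (λ u w → (λ′ + t) * u + w) (sum-δ v c) (sum-neg (λ j → A c j * v j)) ⟩
      (λ′ + t) * v c + - sum (λ j → A c j * v j)           ≡⟨ cong (λ w → (λ′ + t) * v c + - w) (Av≡λv c) ⟩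
      (λ′ + t) * v c + - (λ′ * v c)                        ≡⟨ cancel λ′ t (v c) ⟩
      t * v c                                              ∎
      where
      open ≡-Reasoning
      expand : ∀ w x d a a′ → a ≡ a′ → w * (x * d - a) ≡ x * (w * d) + - (a′ * w)
      expand w x d a a′ refl = lemma w x d a
        where lemma : ∀ w x d a → w * (x * d - a) ≡ x * (w * d) + - (a * w)
              lemma = solve-∀
      cancel : ∀ l t v → (l + t) * v + - (l * v) ≡ t * v
      cancel = solve-∀

    simple-eigenvector-vanishes : ∀ {η w} → IsEigenvector A λ′ η → IsEigenvector A λ′ w →
                                  ∀ {k} → η k ≢ 0ℤ → w k ≡ 0ℤ → ∀ l → w l ≡ 0ℤ
    simple-eigenvector-vanishes {η} {w} Aη≡λη Aw≡λw {k} ηk≢0 wk≡0 l =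
      a*b*c≡0⇒b≡0 ηk≢0 (proj₂ (proj₂ simple)) (divisible-by-all⇒0 (c * evalₚ q λ′) divisible)
      where
      M₁ : ℤ → Matrix n
      M₁ t = N t [ k ]≔ η

      w-row-combination : ∀ t c → sum (λ j → w j * M₁ t j c) ≡ t * w c
      w-row-combination t c = trans (sum-cong-≗ row-k-irrelevant) (xI-A-left-eigenvector Aw≡λw t c)
        where
        row-k-irrelevant : ∀ j → w j * M₁ t j c ≡ w j * N t j c
        row-k-irrelevant j with j ≟ k
        ... | yes refl = trans (cong (_* M₁ t k c) wk≡0) (sym (cong (_* N t k c) wk≡0))
        ... | no  j≢k  = cong (w j *_) (cong-app (updateAt-minimal j k (N t) j≢k) c)

      c = η k * w l

      c*q[λ+t]≡t*D : ∀ t → t ≢ 0ℤ → c * evalₚ q (λ′ + t) ≡ t * det (M₁ t [ l ]≔ w)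
      c*q[λ+t]≡t*D t t≢0 = ℤ.*-cancelˡ-≡ t _ _ {{≢-nonZero t≢0}} (begin
        t * (c * evalₚ q (λ′ + t))           ≡⟨ regroup (η k) (w l) t (evalₚ q (λ′ + t)) ⟩
        w l * (η k * (t * evalₚ q (λ′ + t))) ≡⟨ cong (λ d → w l * (η k * d)) (det-xI-A t) ⟨
        w l * (η k * det (N t))              ≡⟨ cong (w l *_) (det-[]≔-left-eigenvector (N t) k η t (xI-A-left-eigenvector Aη≡λη t)) ⟩
        w l * (t * det (M₁ t))               ≡⟨ swap (w l) t (det (M₁ t)) ⟩
        t * (w l * det (M₁ t))               ≡⟨ cong (t *_) (det-[]≔-left-eigenvector (M₁ t) l w t (w-row-combination t)) ⟩
        t * (t * det (M₁ t [ l ]≔ w))        ∎)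
        where
        open ≡-Reasoning
        regroup : ∀ a b t e → t * ((a * b) * e) ≡ b * (a * (t * e))
        regroup = solve-∀
        swap : ∀ a t d → a * (t * d) ≡ t * (a * d)
        swap = solve-∀

      divisible : ∀ t → t ≢ 0ℤ → ∃ λ y → c * evalₚ q λ′ ≡ t * y
      divisible t t≢0 with eval-shift q λ′ t
      ... | e , q[λ+t]≡q[λ]+te = det (M₁ t [ l ]≔ w) - c * e , (begin
        c * evalₚ q λ′                                ≡⟨ shift c (evalₚ q λ′) t e ⟩
        c * (evalₚ q λ′ + t * e) - t * (c * e)        ≡⟨ cong (λ x → c * x - t * (c * e)) q[λ+t]≡q[λ]+te ⟨
        c * evalₚ q (λ′ + t) - t * (c * e)            ≡⟨ cong (_- t * (c * e)) (c*q[λ+t]≡t*D t t≢0) ⟩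
        t * det (M₁ t [ l ]≔ w) - t * (c * e)         ≡⟨ factor t (det (M₁ t [ l ]≔ w)) (c * e) ⟩
        t * (det (M₁ t [ l ]≔ w) - c * e)             ∎)
        where
        open ≡-Reasoning
        shift : ∀ c q t e → c * q ≡ c * (q + t * e) - t * (c * e)
        shift = solve-∀
        factor : ∀ t d f → t * d - t * f ≡ t * (d - f)
        factor = solve-∀

    simple-eigenvectors-proportional : ∀ {η w} → IsEigenvector A λ′ η → IsEigenvector A λ′ w →
                                       ∀ {k} → η k ≢ 0ℤ → ∀ l → η k * w l ≡ w k * η l
    simple-eigenvectors-proportional {η} {w} Aη≡λη Aw≡λw {k} ηk≢0 l =
      ℤ.i-j≡0⇒i≡j (η k * w l) (w k * η l)
        (simple-eigenvector-vanishes Aη≡λη (eigenvector-combination {M = A} {λ′} {w} {η} Aw≡λw Aη≡λη (η k) (w k)) ηk≢0 vanishes-at-k l)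
      where
      vanishes-at-k : η k * w k - w k * η k ≡ 0ℤ
      vanishes-at-k = trans (cong (_- w k * η k) (ℤ.*-comm (η k) (w k))) (ℤ.+-inverseʳ (w k * η k))

module ℚΣ = RingSums ℚ.+-*-commutativeRing

ℚ-ring : AlmostCommutativeRing 0ℓ 0ℓ
ℚ-ring = fromCommutativeRing ℚ.+-*-commutativeRing (λ x → dec⇒maybe (0ℚ ℚ.≟ x))

module IntegersInRationals where
  open import Data.Nat.Base using (zero; suc)
  import Data.Nat.Properties as ℕ
  open import Data.Fin.Base using (zero; suc)
  import Data.Integer.Base as ℤ
  open import Data.Integer.Base using (+_; 0ℤ; 1ℤ)
  open import Data.Integer.Tactic.RingSolver using (solve-∀)
  import Tactic.RingSolver as ℚ-Solver
  open import Data.Rational.Base using (ℚ; mkℚ; _+_; _*_; _/_; ↥_; ↧_; toℚᵘ)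
  import Data.Rational.Unnormalised.Base as ℚᵘ
  open import Data.Rational.Unnormalised.Base using (*≡*)
  import Data.Rational.Unnormalised.Properties as ℚᵘ
  open import Data.Nat.Coprimality using (1-coprimeTo; sym)
  open import Data.Vec.Functional using (Vector)
  open import Data.Product using (∃; _,_)
  open import Relation.Binary.PropositionalEquality using (refl; trans; cong; cong₂; _≢_; module ≡-Reasoning)
    renaming (sym to ≡-sym)
  open IntegerArithmetic using (a*b≡0⇒b≡0)
  open ℚΣ using (sum)

  private variable n : ℕ

  private
    ι : ℤ → ℚ
    ι z = mkℚ z 0 (sym (1-coprimeTo _))

    toℚ≡ι : ∀ z → toℚ z ≡ ι z
    toℚ≡ι z = ℚ.↥p/↧p≡p (ι z)

  toℚ-+ : ∀ a b → toℚ (a ℤ.+ b) ≡ toℚ a + toℚ b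
  toℚ-+ a b rewrite toℚ≡ι a | toℚ≡ι b =
    cong (_/ 1) (cong₂ ℤ._+_ (≡-sym (ℤ.*-identityʳ a)) (≡-sym (ℤ.*-identityʳ b)))

  toℚ-* : ∀ a b → toℚ (a ℤ.* b) ≡ toℚ a * toℚ b
  toℚ-* a b rewrite toℚ≡ι a | toℚ≡ι b = refl

  toℚ-injective : ∀ {a b} → toℚ a ≡ toℚ b → a ≡ b
  toℚ-injective {a} {b} eq = cong ↥_ (trans (≡-sym (toℚ≡ι a)) (trans eq (toℚ≡ι b)))

  toℚ-sum : ∀ {n} (f : Vector ℤ n) → toℚ (ℤΣ.sum f) ≡ sum (λ i → toℚ (f i))
  toℚ-sum {zero}  f = refl
  toℚ-sum {suc n} f = trans (toℚ-+ (f zero) _) (cong (_+_ (toℚ (f zero))) (toℚ-sum (λ i → f (suc i))))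

  toℚ-numerator : ∀ u → toℚ (↥ u) ≡ toℚ (↧ u) * u
  toℚ-numerator u@(mkℚ a d _) = trans (toℚ≡ι a) (trans (ℚ.toℚᵘ-injective scaled) (cong (_* u) (≡-sym (toℚ≡ι (+ suc d)))))
    where
    scaled : toℚᵘ (ι a) ℚᵘ.≃ toℚᵘ (ι (+ suc d) * u)
    scaled = ℚᵘ.≃-trans (*≡* (trans (cong (λ m → a ℤ.* (+ m)) (ℕ.*-identityˡ (suc d))) (lemma a (+ suc d))))
                         (ℚᵘ.≃-sym (ℚ.toℚᵘ-homo-* (ι (+ suc d)) u))
      where lemma : ∀ a s → a ℤ.* s ≡ (s ℤ.* a) ℤ.* 1ℤ
            lemma = solve-∀

  clear-denominators : ∀ (u : Vector ℚ n) → ∃ λ (N : ℤ) → N ≢ 0ℤ × ∃ λ (U : Vector ℤ n) → ∀ i → toℚ (U i) ≡ toℚ N * u i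
  clear-denominators {zero}  u = 1ℤ , (λ ()) , (λ ()) , (λ ())
  clear-denominators {suc n} u with clear-denominators (λ i → u (suc i))
  ... | N , N≢0 , U , U≡Nu = ↧ u₀ ℤ.* N , ↧u₀N≢0 , V , V≡↧u₀Nu
    where
    u₀ = u zero
    V : Vector ℤ (suc n)
    V zero    = ↥ u₀ ℤ.* N
    V (suc i) = ↧ u₀ ℤ.* U i
    ↧u₀N≢0 : ↧ u₀ ℤ.* N ≢ 0ℤ
    ↧u₀N≢0 ↧u₀N≡0 = N≢0 (a*b≡0⇒b≡0 {↧ u₀} {N} (λ ()) ↧u₀N≡0)
    V≡↧u₀Nu : ∀ i → toℚ (V i) ≡ toℚ (↧ u₀ ℤ.* N) * u i
    V≡↧u₀Nu zero    = begin
      toℚ (↥ u₀ ℤ.* N)              ≡⟨ toℚ-* (↥ u₀) N ⟩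
      toℚ (↥ u₀) * toℚ N            ≡⟨ cong (_* toℚ N) (toℚ-numerator u₀) ⟩
      toℚ (↧ u₀) * u₀ * toℚ N       ≡⟨ swap (toℚ (↧ u₀)) u₀ (toℚ N) ⟩
      toℚ (↧ u₀) * toℚ N * u₀       ≡⟨ cong (_* u₀) (toℚ-* (↧ u₀) N) ⟨
      toℚ (↧ u₀ ℤ.* N) * u₀         ∎
      where
      open ≡-Reasoning
      swap : ∀ d u n → d * u * n ≡ d * n * u
      swap = ℚ-Solver.solve-∀ ℚ-ring
    V≡↧u₀Nu (suc i) = begin
      toℚ (↧ u₀ ℤ.* U i)            ≡⟨ toℚ-* (↧ u₀) (U i) ⟩
      toℚ (↧ u₀) * toℚ (U i)        ≡⟨ cong (toℚ (↧ u₀) *_) (U≡Nu i) ⟩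
      toℚ (↧ u₀) * (toℚ N * u (suc i)) ≡⟨ ℚ.*-assoc (toℚ (↧ u₀)) (toℚ N) (u (suc i)) ⟨
      toℚ (↧ u₀) * toℚ N * u (suc i)   ≡⟨ cong (_* u (suc i)) (toℚ-* (↧ u₀) N) ⟨
      toℚ (↧ u₀ ℤ.* N) * u (suc i)     ∎
      where open ≡-Reasoning

module LinearDependence where
  open import Data.Nat.Base using (zero; suc)
  open import Data.Fin.Base using (zero; suc; punchIn)
  open import Data.Fin.Properties using (all?; ¬∀⟶∃¬)
  open import Data.Rational.Base using (ℚ; 0ℚ; 1ℚ; _+_; _-_; _*_; -_; 1/_; ≢-nonZero)
  open import Data.Vec.Functional using (Vector; insertAt)
  open import Data.Vec.Functional.Properties using (insertAt-lookup; insertAt-punchIn)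
  open import Data.Product using (∃; ∃₂; _×_; _,_; proj₁; proj₂)
  open import Tactic.RingSolver using (solve-∀)
  open import Relation.Binary.PropositionalEquality
    using (sym; trans; cong; cong₂; _≢_; module ≡-Reasoning)
  open import Relation.Nullary using (yes; no)
  open ℚΣ using (sum; sum-cong-≗; sum-remove; sum-zero; sum-linear)

  private variable n : ℕ

  -- A dependency d among the rows reduced against the pivot row p (with multipliers r)
  -- lifts to a dependency among the original rows.
  eliminate-pivot : (v : Vector (Vector ℚ n) (suc n)) (p : Fin (suc n)) (r d : Vector ℚ n) (i : Fin n) →
    sum (λ b → insertAt d p (- sum (λ a → d a * r a)) b * v b i)
      ≡ sum (λ a → d a * (v (punchIn p a) i - r a * v p i))
  eliminate-pivot v p r d i = begin
    sum (λ b → c b * v b i)                                        ≡⟨ sum-remove {i = p} (λ b → c b * v b i) ⟩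
    c p * v p i + sum (λ a → c (punchIn p a) * v (punchIn p a) i)  ≡⟨ cong₂ (λ x y → x * v p i + y) (insertAt-lookup d p (- S))
                                                                              (sum-cong-≗ λ a → cong (_* v (punchIn p a) i) (insertAt-punchIn d p (- S) a)) ⟩
    (- S) * v p i + sum (λ a → d a * v (punchIn p a) i)            ≡⟨ cong (_+ sum (λ a → d a * v (punchIn p a) i)) (neg-swap S (v p i)) ⟩
    (- v p i) * S + sum (λ a → d a * v (punchIn p a) i)            ≡⟨ sum-linear _ _ _ (- v p i) (λ a → distrib (d a) (v (punchIn p a) i) (r a) (v p i)) ⟨
    sum (λ a → d a * (v (punchIn p a) i - r a * v p i))            ∎
    where
    open ≡-Reasoning
    S = sum (λ a → d a * r a)
    c = insertAt d p (- S)
    neg-swap : ∀ s y → (- s) * y ≡ (- y) * s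
    neg-swap = solve-∀ ℚ-ring
    distrib : ∀ d x r y → d * (x - r * y) ≡ (- y) * (d * r) + d * x
    distrib = solve-∀ ℚ-ring

  multiple-of-nonzero : ∀ x {π} → π ≢ 0ℚ → ∃ λ r → x ≡ r * π
  multiple-of-nonzero x {π} π≢0 = x * 1/π , sym (begin
    x * 1/π * π    ≡⟨ ℚ.*-assoc x 1/π π ⟩
    x * (1/π * π)  ≡⟨ cong (x *_) (ℚ.*-inverseˡ π {{≢-nonZero π≢0}}) ⟩
    x * 1ℚ         ≡⟨ ℚ.*-identityʳ x ⟩
    x              ∎)
    where
    open ≡-Reasoning
    1/π = (1/ π) {{≢-nonZero π≢0}}

  *-nonzero-cancel : ∀ {x y} → x ≢ 0ℚ → x * y ≡ 0ℚ → y ≡ 0ℚ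
  *-nonzero-cancel {x} {y} x≢0 xy≡0 = begin
    y               ≡⟨ ℚ.*-identityˡ y ⟨
    1ℚ * y          ≡⟨ cong (_* y) (ℚ.*-inverseˡ x {{≢-nonZero x≢0}}) ⟨
    1/x * x * y     ≡⟨ ℚ.*-assoc 1/x x y ⟩
    1/x * (x * y)   ≡⟨ cong (1/x *_) xy≡0 ⟩
    1/x * 0ℚ        ≡⟨ ℚ.*-zeroʳ 1/x ⟩
    0ℚ              ∎
    where
    open ≡-Reasoning
    1/x = (1/ x) {{≢-nonZero x≢0}}

  pivot : (v : Vector (Vector ℚ (suc n)) (suc (suc n))) →
          ∃₂ λ p r → ∀ a → v (punchIn p a) zero ≡ r a * v p zero
  pivot v with all? (λ a → v a zero ℚ.≟ 0ℚ)
  ... | yes column₀≡0 = zero , (λ _ → 0ℚ) , λ a → trans (column₀≡0 (suc a)) (sym (ℚ.*-zeroˡ (v zero zero)))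
  ... | no  column₀≢0 with ¬∀⟶∃¬ _ _ (λ a → v a zero ℚ.≟ 0ℚ) column₀≢0
  ...   | p , vp≢0 = p , (λ a → proj₁ (multiple a)) , (λ a → proj₂ (multiple a))
    where multiple = λ a → multiple-of-nonzero (v (punchIn p a) zero) vp≢0

  linearly-dependent : (v : Vector (Vector ℚ n) (suc n)) →
                       ∃ λ (c : Vector ℚ (suc n)) → (∃ λ a → c a ≢ 0ℚ) × (∀ i → sum (λ a → c a * v a i) ≡ 0ℚ)
  linearly-dependent {zero}  v = (λ _ → 1ℚ) , (zero , ℚ.1≢0) , λ ()
  linearly-dependent {suc n} v with pivot v
  ... | p , r , pivot-column with linearly-dependent (λ a i → v (punchIn p a) (suc i) - r a * v p (suc i))
  ... | d , (a₀ , da₀≢0) , reduced≡0 = c , (punchIn p a₀ , ca₀≢0) , combination≡0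
    where
    c = insertAt d p (- sum (λ a → d a * r a))
    ca₀≢0 : c (punchIn p a₀) ≢ 0ℚ
    ca₀≢0 ca₀≡0 = da₀≢0 (trans (sym (insertAt-punchIn d p _ a₀)) ca₀≡0)
    combination≡0 : ∀ i → sum (λ b → c b * v b i) ≡ 0ℚ
    combination≡0 zero    = trans (eliminate-pivot v p r d zero) (sum-zero λ a →
      trans (cong (λ x → d a * (x - r a * v p zero)) (pivot-column a))
            (trans (cong (d a *_) (ℚ.+-inverseʳ (r a * v p zero))) (ℚ.*-zeroʳ (d a))))
    combination≡0 (suc i) = trans (eliminate-pivot v p r d (suc i)) (reduced≡0 i)

module OrthogonalMatrices where
  open import Data.Nat.Base using (zero; suc)
  open import Data.Fin.Base using (zero; suc)
  open import Data.Fin.Properties using (_≟_)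
  open import Data.Rational.Base using (ℚ; 0ℚ; 1ℚ; _+_; _*_; -_)
  open import Data.Vec.Functional using (Vector; _∷_)
  open import Data.Product using (_,_)
  open import Data.Empty using (⊥-elim)
  open import Tactic.RingSolver using (solve-∀)
  open import Relation.Binary.PropositionalEquality
    using (refl; sym; trans; cong; _≢_; module ≡-Reasoning)
  open import Relation.Nullary using (yes; no)
  open ℚΣ using (sum; sum-cong-≗; sum-zero; sum-single; sum-linear; ∑-comm; *-distribˡ-sum; *-distribʳ-sum)
  open LinearDependence using (linearly-dependent; *-nonzero-cancel)

  private variable n : ℕ

  ∑ℚ≡sum : ∀ n (f : Vector ℚ n) → ∑ℚ n f ≡ sum f
  ∑ℚ≡sum zero    f = refl
  ∑ℚ≡sum (suc n) f = cong (f zero +_) (∑ℚ≡sum n (λ i → f (suc i)))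

  _*ᵥ_ : MatQ n → Vector ℚ n → Vector ℚ n
  (M *ᵥ v) i = sum λ j → M i j * v j

  ⟨_,_⟩ : Vector ℚ n → Vector ℚ n → ℚ
  ⟨ u , v ⟩ = sum λ i → u i * v i

  *ᵥ-cong : ∀ {M N : MatQ n} → M ≡ₘ N → ∀ v i → (M *ᵥ v) i ≡ (N *ᵥ v) i
  *ᵥ-cong M≡N v i = sum-cong-≗ λ j → cong (_* v j) (M≡N i j)

  *ᵥ-linear : ∀ (M : MatQ n) a x y i → (M *ᵥ (λ j → a * x j + y j)) i ≡ a * (M *ᵥ x) i + (M *ᵥ y) i
  *ᵥ-linear M a x y i = sum-linear _ _ _ a λ j → distrib (M i j) a (x j) (y j)
    where distrib : ∀ m a x y → m * (a * x + y) ≡ a * (m * x) + m * y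
          distrib = solve-∀ ℚ-ring

  *ᵥ-scale : ∀ (M : MatQ n) a x i → (M *ᵥ (λ j → a * x j)) i ≡ a * (M *ᵥ x) i
  *ᵥ-scale M a x i = trans (sum-cong-≗ λ j → swap (M i j) a (x j)) (sym (*-distribˡ-sum a (λ j → M i j * x j)))
    where swap : ∀ m a x → m * (a * x) ≡ a * (m * x)
          swap = solve-∀ ℚ-ring

  ·-*ᵥ : ∀ (M N : MatQ n) v i → ((M · N) *ᵥ v) i ≡ (M *ᵥ (N *ᵥ v)) i
  ·-*ᵥ {n} M N v i = begin
    sum (λ j → ∑ℚ n (λ k → M i k * N k j) * v j)      ≡⟨ sum-cong-≗ (λ j → cong (_* v j) (∑ℚ≡sum n (λ k → M i k * N k j))) ⟩
    sum (λ j → sum (λ k → M i k * N k j) * v j)       ≡⟨ sum-cong-≗ (λ j → *-distribʳ-sum (v j) (λ k → M i k * N k j)) ⟩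
    sum (λ j → sum (λ k → M i k * N k j * v j))       ≡⟨ ∑-comm (λ j k → M i k * N k j * v j) ⟩
    sum (λ k → sum (λ j → M i k * N k j * v j))       ≡⟨ sum-cong-≗ (λ k → sum-cong-≗ λ j → ℚ.*-assoc (M i k) (N k j) (v j)) ⟩
    sum (λ k → sum (λ j → M i k * (N k j * v j)))     ≡⟨ sum-cong-≗ (λ k → *-distribˡ-sum (M i k) (λ j → N k j * v j)) ⟨
    sum (λ k → M i k * sum (λ j → N k j * v j))       ∎
    where open ≡-Reasoning

  idQ-*ᵥ : ∀ (v : Vector ℚ n) i → (idQ *ᵥ v) i ≡ v i
  idQ-*ᵥ v i = trans (sum-single i _ off-diagonal) (trans (cong (_* v i) diagonal) (ℚ.*-identityˡ (v i)))
    where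
    off-diagonal : ∀ j → j ≢ i → idQ i j * v j ≡ 0ℚ
    off-diagonal j j≢i with i ≟ j
    ... | yes i≡j = ⊥-elim (j≢i (sym i≡j))
    ... | no  _   = ℚ.*-zeroˡ (v j)
    diagonal : idQ i i ≡ 1ℚ
    diagonal with i ≟ i
    ... | yes _   = refl
    ... | no  i≢i = ⊥-elim (i≢i refl)

  *ᵥ-transpose : ∀ (M : MatQ n) u w → ⟨ M *ᵥ u , w ⟩ ≡ ⟨ u , transpose M *ᵥ w ⟩
  *ᵥ-transpose M u w = begin
    sum (λ i → sum (λ j → M i j * u j) * w i)         ≡⟨ sum-cong-≗ (λ i → *-distribʳ-sum (w i) (λ j → M i j * u j)) ⟩
    sum (λ i → sum (λ j → M i j * u j * w i))         ≡⟨ ∑-comm (λ i j → M i j * u j * w i) ⟩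
    sum (λ j → sum (λ i → M i j * u j * w i))         ≡⟨ sum-cong-≗ (λ j → sum-cong-≗ λ i → regroup (M i j) (u j) (w i)) ⟩
    sum (λ j → sum (λ i → u j * (M i j * w i)))       ≡⟨ sum-cong-≗ (λ j → *-distribˡ-sum (u j) (λ i → M i j * w i)) ⟨
    sum (λ j → u j * sum (λ i → M i j * w i))         ∎
    where
    open ≡-Reasoning
    regroup : ∀ m u w → m * u * w ≡ u * (m * w)
    regroup = solve-∀ ℚ-ring

  module _ {Q : MatQ n} (orthogonal : RationalOrthogonal Q) where

    transpose-*ᵥ-cancel : ∀ v i → (transpose Q *ᵥ (Q *ᵥ v)) i ≡ v i
    transpose-*ᵥ-cancel v i = trans (sym (·-*ᵥ (transpose Q) Q v i)) (trans (*ᵥ-cong orthogonal v i) (idQ-*ᵥ v i))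

    preserves-norm : ∀ v → ⟨ Q *ᵥ v , Q *ᵥ v ⟩ ≡ ⟨ v , v ⟩
    preserves-norm v = trans (*ᵥ-transpose Q v (Q *ᵥ v)) (sum-cong-≗ λ i → cong (v i *_) (transpose-*ᵥ-cancel v i))

    -- z together with the columns of Q are n + 1 vectors in ℚⁿ, hence dependent;
    -- orthogonality forces every coefficient but that of z to vanish.
    transpose-kernel : ∀ z → (∀ b → (transpose Q *ᵥ z) b ≡ 0ℚ) → ∀ i → z i ≡ 0ℚ
    transpose-kernel z Qᵀz≡0 i with linearly-dependent (z ∷ transpose Q)
    ... | c , (a₀ , ca₀≢0) , combination≡0 = *-nonzero-cancel c₀≢0 c₀zᵢ≡0
      where
      c′ = λ a → c (suc a)
      Qc′ : ∀ i → sum (λ a → c′ a * Q i a) ≡ (Q *ᵥ c′) i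
      Qc′ i = sum-cong-≗ λ a → ℚ.*-comm (c′ a) (Q i a)
      c′≡0 : ∀ b → c′ b ≡ 0ℚ
      c′≡0 b = begin
        c′ b                                                         ≡⟨ transpose-*ᵥ-cancel c′ b ⟨
        (transpose Q *ᵥ (Q *ᵥ c′)) b                                 ≡⟨ ℚ.+-identityˡ _ ⟨
        0ℚ + (transpose Q *ᵥ (Q *ᵥ c′)) b                            ≡⟨ cong (_+ (transpose Q *ᵥ (Q *ᵥ c′)) b)
                                                                         (sym (trans (cong (c zero *_) (Qᵀz≡0 b)) (ℚ.*-zeroʳ (c zero)))) ⟩
        c zero * (transpose Q *ᵥ z) b + (transpose Q *ᵥ (Q *ᵥ c′)) b ≡⟨ *ᵥ-linear (transpose Q) (c zero) z (Q *ᵥ c′) b ⟨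
        (transpose Q *ᵥ (λ i → c zero * z i + (Q *ᵥ c′) i)) b         ≡⟨ sum-zero (λ i → trans (cong (Q i b *_)
                                                                            (trans (cong (c zero * z i +_) (sym (Qc′ i))) (combination≡0 i)))
                                                                            (ℚ.*-zeroʳ (Q i b))) ⟩
        0ℚ                                                           ∎
        where open ≡-Reasoning
      c₀≢0 : c zero ≢ 0ℚ
      c₀≢0 = nonzero-coefficient-is-c₀ a₀ ca₀≢0
        where
        nonzero-coefficient-is-c₀ : ∀ a → c a ≢ 0ℚ → c zero ≢ 0ℚ
        nonzero-coefficient-is-c₀ zero    c₀≢0  = c₀≢0
        nonzero-coefficient-is-c₀ (suc a) ca≢0 = ⊥-elim (ca≢0 (c′≡0 a))
      c₀zᵢ≡0 : c zero * z i ≡ 0ℚ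
      c₀zᵢ≡0 = trans (sym (ℚ.+-identityʳ _)) (trans (cong (c zero * z i +_) (sym (sum-zero λ a → trans (cong (_* Q i a) (c′≡0 a)) (ℚ.*-zeroˡ (Q i a))))) (combination≡0 i))

    transpose-injective : ∀ {x y} → (∀ b → (transpose Q *ᵥ x) b ≡ (transpose Q *ᵥ y) b) → ∀ i → x i ≡ y i
    transpose-injective {x} {y} Qᵀx≡Qᵀy i = begin
      x i                         ≡⟨ split (x i) (y i) ⟩
      ((- 1ℚ) * y i + x i) + y i  ≡⟨ cong (_+ y i) (transpose-kernel (λ j → (- 1ℚ) * y j + x j) Qᵀ[x-y]≡0 i) ⟩
      0ℚ + y i                    ≡⟨ ℚ.+-identityˡ (y i) ⟩
      y i                         ∎
      where
      open ≡-Reasoning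
      split : ∀ x y → x ≡ ((- 1ℚ) * y + x) + y
      split = solve-∀ ℚ-ring
      cancel : ∀ u → (- 1ℚ) * u + u ≡ 0ℚ
      cancel = solve-∀ ℚ-ring
      Qᵀ[x-y]≡0 : ∀ b → (transpose Q *ᵥ (λ j → (- 1ℚ) * y j + x j)) b ≡ 0ℚ
      Qᵀ[x-y]≡0 b = trans (*ᵥ-linear (transpose Q) (- 1ℚ) y x b)
                          (trans (cong ((- 1ℚ) * (transpose Q *ᵥ y) b +_) (Qᵀx≡Qᵀy b)) (cancel ((transpose Q *ᵥ y) b)))

    similar-eigenvector : ∀ {A B : MatQ n} {λ′ v} → A ≡ₘ ((transpose Q · B) · Q) →
                          (∀ i → (A *ᵥ v) i ≡ λ′ * v i) → ∀ i → (B *ᵥ (Q *ᵥ v)) i ≡ λ′ * (Q *ᵥ v) i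
    similar-eigenvector {A = A} {B} {λ′} {v} A≡QᵀBQ Av≡λv = transpose-injective λ b → begin
      (transpose Q *ᵥ (B *ᵥ (Q *ᵥ v))) b      ≡⟨ ·-*ᵥ (transpose Q) B (Q *ᵥ v) b ⟨
      ((transpose Q · B) *ᵥ (Q *ᵥ v)) b        ≡⟨ ·-*ᵥ (transpose Q · B) Q v b ⟨
      (((transpose Q · B) · Q) *ᵥ v) b         ≡⟨ *ᵥ-cong A≡QᵀBQ v b ⟨
      (A *ᵥ v) b                              ≡⟨ Av≡λv b ⟩
      λ′ * v b                                ≡⟨ cong (λ′ *_) (transpose-*ᵥ-cancel v b) ⟨
      λ′ * (transpose Q *ᵥ (Q *ᵥ v)) b         ≡⟨ *ᵥ-scale (transpose Q) λ′ (Q *ᵥ v) b ⟨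
      (transpose Q *ᵥ (λ j → λ′ * (Q *ᵥ v) j)) b ∎
      where open ≡-Reasoning

module SquareRatio where
  open import Data.Integer.Base using (0ℤ; _*_)
  open import Data.Rational.Base as ℚ using (ℚ; 0ℚ; 1ℚ; -_; ∣_∣; 1/_; _≤_; ≢-nonZero)
  open import Data.Product using (_,_)
  open import Data.Sum using (inj₁; inj₂)
  open import Tactic.RingSolver using (solve-∀)
  open import Relation.Binary.PropositionalEquality using (trans; cong; _≢_; module ≡-Reasoning)
  open IntegersInRationals using (toℚ-*; toℚ-injective)

  ∣q∣*∣q∣≡q*q : ∀ q → ∣ q ∣ ℚ.* ∣ q ∣ ≡ q ℚ.* q
  ∣q∣*∣q∣≡q*q q with ℚ.∣p∣≡p∨∣p∣≡-p q
  ... | inj₁ ∣q∣≡q  = cong (λ x → x ℚ.* x) ∣q∣≡q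
  ... | inj₂ ∣q∣≡-q = trans (cong (λ x → x ℚ.* x) ∣q∣≡-q) (neg-square q)
    where neg-square : ∀ q → (- q) ℚ.* (- q) ≡ q ℚ.* q
          neg-square = solve-∀ ℚ-ring

  square-ratio : ∀ a b x y → b ≢ 0ℤ → (a * a) * x ≡ (b * b) * y →
                 Σ ℚ λ r → 0ℚ ≤ r × (r ℚ.* r) ℚ.* toℚ x ≡ toℚ y
  square-ratio a b x y b≢0 a²x≡b²y = ∣ q ∣ , ℚ.0≤∣p∣ q , (begin
    ∣ q ∣ ℚ.* ∣ q ∣ ℚ.* x′                 ≡⟨ cong (ℚ._* x′) (∣q∣*∣q∣≡q*q q) ⟩
    q ℚ.* q ℚ.* x′                         ≡⟨ regroup a′ 1/b x′ ⟩
    1/b ℚ.* 1/b ℚ.* (a′ ℚ.* a′ ℚ.* x′)     ≡⟨ cong (1/b ℚ.* 1/b ℚ.*_) (toℚ-square-* a x) ⟨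
    1/b ℚ.* 1/b ℚ.* toℚ (a * a * x)        ≡⟨ cong (λ z → 1/b ℚ.* 1/b ℚ.* toℚ z) a²x≡b²y ⟩
    1/b ℚ.* 1/b ℚ.* toℚ (b * b * y)        ≡⟨ cong (1/b ℚ.* 1/b ℚ.*_) (toℚ-square-* b y) ⟩
    1/b ℚ.* 1/b ℚ.* (b′ ℚ.* b′ ℚ.* y′)     ≡⟨ regroup b′ 1/b y′ ⟨
    (b′ ℚ.* 1/b) ℚ.* (b′ ℚ.* 1/b) ℚ.* y′   ≡⟨ cong (λ e → e ℚ.* e ℚ.* y′) (ℚ.*-inverseʳ b′ {{≢-nonZero b′≢0}}) ⟩
    1ℚ ℚ.* 1ℚ ℚ.* y′                       ≡⟨ ℚ.*-identityˡ y′ ⟩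
    y′                                     ∎)
    where
    open ≡-Reasoning
    a′ = toℚ a
    b′ = toℚ b
    x′ = toℚ x
    y′ = toℚ y
    b′≢0 : b′ ≢ 0ℚ
    b′≢0 b′≡0 = b≢0 (toℚ-injective b′≡0)
    1/b = (1/ b′) {{≢-nonZero b′≢0}}
    q = a′ ℚ.* 1/b
    regroup : ∀ a c x → (a ℚ.* c) ℚ.* (a ℚ.* c) ℚ.* x ≡ c ℚ.* c ℚ.* (a ℚ.* a ℚ.* x)
    regroup = solve-∀ ℚ-ring
    toℚ-square-* : ∀ a x → toℚ (a * a * x) ≡ toℚ a ℚ.* toℚ a ℚ.* toℚ x
    toℚ-square-* a x = trans (toℚ-* (a * a) x) (cong (ℚ._* toℚ x) (toℚ-* a a))

module IntegralEigenvectors where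
  open import Data.Nat.Base using (zero; suc)
  open import Data.Fin.Base using (zero; suc)
  open import Data.Integer.Base using (0ℤ; 1ℤ) renaming (_+_ to _+ℤ_; _*_ to _*ℤ_)
  open import Data.Rational.Base using (ℚ; _*_)
  open import Data.Vec.Functional using (Vector)
  open import Data.Bool.Base using (if_then_else_)
  open import Data.Product using (_,_)
  open import Tactic.RingSolver using (solve-∀)
  open import Function.Base using (_∘_)
  open import Relation.Binary.PropositionalEquality using (refl; sym; trans; cong; module ≡-Reasoning)
  open Determinant using (Matrix)
  open SimpleEigenvalue using (IsEigenvector)
  open IntegersInRationals using (toℚ-*; toℚ-sum; toℚ-injective)
  open OrthogonalMatrices using (_*ᵥ_; ⟨_,_⟩; *ᵥ-scale)
  open ℚΣ using (sum-cong-≗)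

  private variable n : ℕ

  adjacency-symmetric : (G : Graph n) → ∀ i j → A G i j ≡ A G j i
  adjacency-symmetric G i j = cong (λ b → if b then 1ℤ else 0ℤ) (Graph.symmetric G i j)

  ∑ℤ≡sum : ∀ n (f : Vector ℤ n) → ∑ℤ n f ≡ ℤΣ.sum f
  ∑ℤ≡sum zero    f = refl
  ∑ℤ≡sum (suc n) f = cong (f zero +ℤ_) (∑ℤ≡sum n (λ i → f (suc i)))

  integral-eigenvector : ∀ {M : Matrix n} {λ′ ξ} → IntegralEigenvector M λ′ ξ → IsEigenvector M λ′ ξ
  integral-eigenvector {n} {M} {ξ = ξ} (_ , Mξ≡λξ) i = trans (sym (∑ℤ≡sum n (λ j → M i j *ℤ ξ j))) (Mξ≡λξ i)

  toℚ-*ᵥ : ∀ (M : Matrix n) v i → (toMatQ M *ᵥ (toℚ ∘ v)) i ≡ toℚ (ℤΣ.sum λ j → M i j *ℤ v j)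
  toℚ-*ᵥ M v i = sym (trans (toℚ-sum (λ j → M i j *ℤ v j)) (sum-cong-≗ λ j → toℚ-* (M i j) (v j)))

  toℚ-eigenvector : ∀ {M : Matrix n} {λ′ v} → IsEigenvector M λ′ v → ∀ i → (toMatQ M *ᵥ (toℚ ∘ v)) i ≡ toℚ λ′ * toℚ (v i)
  toℚ-eigenvector {M = M} {λ′} {v} Mv≡λv i = trans (toℚ-*ᵥ M v i) (trans (cong toℚ (Mv≡λv i)) (toℚ-* λ′ (v i)))

  scaled-eigenvector : ∀ {M : Matrix n} {λ′ N W} {w : Vector ℚ n} → (∀ i → (toMatQ M *ᵥ w) i ≡ toℚ λ′ * w i) →
                       (∀ i → toℚ (W i) ≡ toℚ N * w i) → IsEigenvector M λ′ W
  scaled-eigenvector {M = M} {λ′} {N} {W} {w} Mw≡λw W≡Nw i = toℚ-injective (begin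
    toℚ (ℤΣ.sum λ j → M i j *ℤ W j)      ≡⟨ toℚ-*ᵥ M W i ⟨
    (toMatQ M *ᵥ (toℚ ∘ W)) i            ≡⟨ sum-cong-≗ (λ j → cong (toℚ (M i j) *_) (W≡Nw j)) ⟩
    (toMatQ M *ᵥ (λ j → toℚ N * w j)) i   ≡⟨ *ᵥ-scale (toMatQ M) (toℚ N) w i ⟩
    toℚ N * (toMatQ M *ᵥ w) i             ≡⟨ cong (toℚ N *_) (Mw≡λw i) ⟩
    toℚ N * (toℚ λ′ * w i)                ≡⟨ swap (toℚ N) (toℚ λ′) (w i) ⟩
    toℚ λ′ * (toℚ N * w i)                ≡⟨ cong (toℚ λ′ *_) (W≡Nw i) ⟨
    toℚ λ′ * toℚ (W i)                    ≡⟨ toℚ-* λ′ (W i) ⟨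
    toℚ (λ′ *ℤ W i)                       ∎)
    where
    open ≡-Reasoning
    swap : ∀ a b c → a * (b * c) ≡ b * (a * c)
    swap = solve-∀ ℚ-ring

  normSq≡sum : (v : Vector ℤ n) → normSq v ≡ ℤΣ.sum (λ i → v i *ℤ v i)
  normSq≡sum {n} v = ∑ℤ≡sum n (λ i → v i *ℤ v i)

  toℚ-normSq : (v : Vector ℤ n) → toℚ (normSq v) ≡ ⟨ toℚ ∘ v , toℚ ∘ v ⟩
  toℚ-normSq v = trans (cong toℚ (normSq≡sum v)) (trans (toℚ-sum (λ i → v i *ℤ v i)) (sum-cong-≗ λ i → toℚ-* (v i) (v i)))

module NormRatio where
  open import Data.Integer.Base using (0ℤ; _*_)
  open import Data.Rational.Base using (ℚ; 0ℚ) renaming (_*_ to _*ℚ_; _≤_ to _≤ℚ_)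
  open import Data.Vec.Functional using (Vector)
  open import Data.Product using (_,_; proj₁; proj₂)
  open import Function.Base using (_∘_)
  open import Data.Integer.Tactic.RingSolver using (solve-∀)
  open import Relation.Binary.PropositionalEquality using (sym; trans; cong; _≢_; module ≡-Reasoning)
  open Determinant using (Matrix)
  open SimpleEigenvalue using (IsEigenvector; simple-eigenvectors-proportional)
  open IntegerArithmetic using (a*b≡0⇒b≡0)
  open IntegersInRationals using (toℚ-*; toℚ-injective; clear-denominators)
  open LinearDependence using (*-nonzero-cancel)
  open OrthogonalMatrices
  open IntegralEigenvectors
  open SquareRatio using (square-ratio)

  module _ {n} (A₁ A₂ : Matrix n) (λ′ : ℤ) (ξ η : Vector ℤ n) (Q : MatQ n)
           (A₂-sym : ∀ i j → A₂ i j ≡ A₂ j i) (simple : SimpleEigenvalue A₂ λ′)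
           (ξ-eigen : IntegralEigenvector A₁ λ′ ξ) (η-eigen : IntegralEigenvector A₂ λ′ η)
           (orthogonal : RationalOrthogonal Q) (similar : toMatQ A₁ ≡ₘ ((transpose Q · toMatQ A₂) · Q)) where

    private
      A₁ξ≡λξ = integral-eigenvector {M = A₁} {λ′} {ξ} ξ-eigen
      A₂η≡λη = integral-eigenvector {M = A₂} {λ′} {η} η-eigen
      k = proj₁ (proj₁ η-eigen)
      ηk≢0 = proj₂ (proj₁ η-eigen)

      w : Vector ℚ n
      w = Q *ᵥ (toℚ ∘ ξ)

      scaling = clear-denominators w
      N = proj₁ scaling
      N≢0 = proj₁ (proj₂ scaling)
      W = proj₁ (proj₂ (proj₂ scaling))
      W≡Nw = proj₂ (proj₂ (proj₂ scaling))

      A₂W≡λW : IsEigenvector A₂ λ′ W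
      A₂W≡λW = scaled-eigenvector {M = A₂} {λ′} {N} {W} {w}
        (similar-eigenvector {Q = Q} orthogonal {toMatQ A₁} {toMatQ A₂} {toℚ λ′} {toℚ ∘ ξ} similar (toℚ-eigenvector {M = A₁} {λ′} {ξ} A₁ξ≡λξ))
        W≡Nw

      ηk*W≡Wk*η : ∀ l → η k * W l ≡ W k * η l
      ηk*W≡Wk*η = simple-eigenvectors-proportional A₂-sym simple A₂η≡λη A₂W≡λW ηk≢0

      normSq-W : normSq W ≡ (N * N) * normSq ξ
      normSq-W = toℚ-injective (begin
        toℚ (normSq W)                                           ≡⟨ toℚ-normSq W ⟩
        ⟨ toℚ ∘ W , toℚ ∘ W ⟩                                     ≡⟨ ℚΣ.sum-cong-≗ (λ i → cong (λ x → x *ℚ x) (W≡Nw i)) ⟩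
        ⟨ (λ i → toℚ N *ℚ w i) , (λ i → toℚ N *ℚ w i) ⟩           ≡⟨ ℚΣ.sum-scaled-squares (toℚ N) w ⟩
        (toℚ N *ℚ toℚ N) *ℚ ⟨ w , w ⟩                             ≡⟨ cong ((toℚ N *ℚ toℚ N) *ℚ_) (preserves-norm {Q = Q} orthogonal (toℚ ∘ ξ)) ⟩
        (toℚ N *ℚ toℚ N) *ℚ ⟨ toℚ ∘ ξ , toℚ ∘ ξ ⟩                  ≡⟨ cong ((toℚ N *ℚ toℚ N) *ℚ_) (toℚ-normSq ξ) ⟨
        (toℚ N *ℚ toℚ N) *ℚ toℚ (normSq ξ)                        ≡⟨ cong (_*ℚ toℚ (normSq ξ)) (toℚ-* N N) ⟨
        toℚ (N * N) *ℚ toℚ (normSq ξ)                             ≡⟨ toℚ-* (N * N) (normSq ξ) ⟨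
        toℚ ((N * N) * normSq ξ)                                  ∎)
        where open ≡-Reasoning

      W≡0 : W k ≡ 0ℤ → ∀ l → W l ≡ 0ℤ
      W≡0 Wk≡0 l = a*b≡0⇒b≡0 ηk≢0 (trans (ηk*W≡Wk*η l) (cong (_* η l) Wk≡0))

      Wk≢0 : W k ≢ 0ℤ
      Wk≢0 Wk≡0 = proj₂ (proj₁ ξ-eigen) (toℚ-injective {ξ i₀} {0ℤ} (begin
        toℚ (ξ i₀)              ≡⟨ transpose-*ᵥ-cancel {Q = Q} orthogonal (toℚ ∘ ξ) i₀ ⟨
        (transpose Q *ᵥ w) i₀   ≡⟨ ℚΣ.sum-zero (λ j → trans (cong (Q j i₀ *ℚ_) (w≡0 j)) (ℚ.*-zeroʳ (Q j i₀))) ⟩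
        0ℚ                      ∎))
        where
        open ≡-Reasoning
        i₀ = proj₁ (proj₁ ξ-eigen)
        toℚN≢0 : toℚ N ≢ 0ℚ
        toℚN≢0 toℚN≡0 = N≢0 (toℚ-injective {N} {0ℤ} toℚN≡0)
        w≡0 : ∀ j → w j ≡ 0ℚ
        w≡0 j = *-nonzero-cancel {toℚ N} {w j} toℚN≢0 (trans (sym (W≡Nw j)) (cong toℚ (W≡0 Wk≡0 j)))

      norm-identity : ((η k * N) * (η k * N)) * normSq ξ ≡ (W k * W k) * normSq η
      norm-identity = begin
        ((η k * N) * (η k * N)) * normSq ξ             ≡⟨ regroup (η k) N (normSq ξ) ⟩
        (η k * η k) * ((N * N) * normSq ξ)             ≡⟨ cong ((η k * η k) *_) (trans (sym normSq-W) (normSq≡sum W)) ⟩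
        (η k * η k) * ℤΣ.sum (λ l → W l * W l)         ≡⟨ ℤΣ.sum-scaled-squares (η k) W ⟨
        ℤΣ.sum (λ l → (η k * W l) * (η k * W l))       ≡⟨ ℤΣ.sum-cong-≗ (λ l → cong (λ x → x * x) (ηk*W≡Wk*η l)) ⟩
        ℤΣ.sum (λ l → (W k * η l) * (W k * η l))       ≡⟨ ℤΣ.sum-scaled-squares (W k) η ⟩
        (W k * W k) * ℤΣ.sum (λ l → η l * η l)         ≡⟨ cong ((W k * W k) *_) (normSq≡sum η) ⟨
        (W k * W k) * normSq η                         ∎
        where
        open ≡-Reasoning
        regroup : ∀ e n x → ((e * n) * (e * n)) * x ≡ (e * e) * ((n * n) * x)
        regroup = solve-∀

    norm-ratio-rational : Σ ℚ λ r → 0ℚ ≤ℚ r × (r *ℚ r) *ℚ toℚ (normSq ξ) ≡ toℚ (normSq η)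
    norm-ratio-rational = square-ratio (η k * N) (W k) (normSq ξ) (normSq η) Wk≢0 norm-identity

open import Data.Product using (_,_)
open IntegralEigenvectors using (adjacency-symmetric)
open NormRatio using (norm-ratio-rational)

lemma1 : ∀ {n : ℕ} (G₁ G₂ : Graph n) (λ′ : ℤ) (ξ η : Fin n → ℤ)
  → Cospectral G₁ G₂
  → SimpleEigenvalue (A G₁) λ′
  → SimpleEigenvalue (A G₂) λ′
  → IntegralEigenvector (A G₁) λ′ ξ
  → IntegralEigenvector (A G₂) λ′ η
  → NormRatioIrrational ξ η
  → ¬ (Σ (MatQ n) (λ Q → RationalOrthogonal Q
         × (toMatQ (A G₁) ≡ₘ ((transpose Q · toMatQ (A G₂)) · Q))))
lemma1 G₁ G₂ λ′ ξ η _ _ simple₂ ξ-eigen η-eigen irrational (Q , orthogonal , similar) =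
  irrational (norm-ratio-rational (A G₁) (A G₂) λ′ ξ η Q (adjacency-symmetric G₂) simple₂ ξ-eigen η-eigen orthogonal similar)
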